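{- Let $G$, $k$, $H$, $m$, $\prec$, $\omega$, $G_H$ and $f$ be as in the construction described in the context, and let $Y\subseteq V(G_H)$ be colourful under $f$. Then $G_H[Y]$ is isomorphic to a subgraph of $H$. Moreover, $G_H[Y]$ is isomorphic to $H$ if and only if, for every $u\in Y\cap V(H^{(v,e)}_{(i,\{j,l\})})$ and $w\in Y\cap V(H^{(v',e')}_{(i',\{j',l'\})})$ such that $\omega^{ -1}(f(u))\omega^{ -1}(f(w))\in E(H)$, the following hold: (1) if $i=i'$ then $v=v'$, and if $i<i'$ then $v\prec v'$; (2) if $\{j,l\}=\{j',l'\}$ then $e=e'$.
   Context: Construction. Let $G$ be a simple graph, $k\in\mathbb{N}$, and $H$ a simple graph containing as a minor the grid $A$ with $k$ rows indexed by $[k]$ and $\binom{k}{2}$ columns indexed by the 2-element subsets of $[k]$; write $a_{(i,\{j,l\})}$ for the vertex in row $i$ and column $\{j,l\}$. Fix a minor map $m:V(A)\to\mathcal{P}(V(H))$ (each $H[m(a)]$ connected, the sets $m(a)$ pairwise disjoint, and for each edge $aa'$ of $A$ some edge of $H$ joins $m(a)$ and $m(a')$). Let $V_H'=V(H)\setminus\bigcup_{a}m(a)$. Fix a total order $\prec$ on $V(G)$ and a bijective colouring $\omega:V(H)\to\{1,\dots,|V(H)|\}$. For each $(i,\{j,l\})\in[k]\times[k]^{(2)}$ and each $(v,e)\in V(G)\times E(G)$ such that ($i\in\{j,l\}\Rightarrow v$ is incident with $e$), take a fresh copy $H^{(v,e)}_{(i,\{j,l\})}$ of $H[m(a_{(i,\{j,l\})})]$,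 writing $u^{(v,e)}$ for the copy of $u$. $V(G_H)$ is the union of the vertex sets of all these copies together with $V_H'$. The colouring $f$ of $V(G_H)$ with colours $\{1,\dots,|V(H)|\}$ is $f(u)=\omega(u)$ for $u\in V_H'$ and $f(u^{(v,e)})=\omega(u)$. Two vertices $u,w$ of $G_H$ are adjacent iff (Condition 1) $\omega^{ -1}(f(u))\omega^{ -1}(f(w))\in E(H)$, and (Condition 2) if $u\in V(H^{(v,e)}_{(i,\{j,l\})})$ and $w\in V(H^{(v',e')}_{(i',\{j',l'\})})$ then: if $i=i'$ then $v=v'$, if $i<i'$ then $v\prec v'$, and if $\{j,l\}=\{j',l'\}$ then $e=e'$. A subset $Y\subseteq V(G_H)$ is colourful under $f$ if it contains exactly one vertex of each colour $1,\dots,|V(H)|$. -}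

module Defs where

open import Level using (0ℓ)
open import Data.Nat using (ℕ; suc)
open import Data.Fin using (Fin; toℕ) renaming (_<_ to _<ᶠ_)
open import Data.Bool using (Bool; true; false; T)
open import Data.Product using (Σ; ∃; _×_; _,_; proj₁)
open import Data.Sum using (_⊎_)
open import Data.Unit using (⊤)
open import Relation.Nullary using (¬_)
open import Relation.Binary.Core using (Rel)
open import Relation.Binary.PropositionalEquality using (_≡_)
open import Function.Bundles using (_↔_; Inverse)
open import Function.Definitions using (Injective)

record SimpleGraph (n : ℕ) : Set where
  field
    adj        : Fin n → Fin n → Bool
    adj-sym    : ∀ x y → adj x y ≡ adj y x
    adj-irrefl : ∀ x → adj x x ≡ false

  Adj : Fin n → Fin n → Set
  Adj x y = T (adj x y)

open SimpleGraph public using (Adj)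

-- An edge {lo,hi} of G, represented uniquely with lo < hi.
record Edge {n : ℕ} (G : SimpleGraph n) : Set where
  constructor edge
  field
    lo hi  : Fin n
    .lo<hi : lo <ᶠ hi
    .isAdj : Adj G lo hi

Incident : ∀ {n} {G : SimpleGraph n} → Fin n → Edge G → Set
Incident v e = v ≡ Edge.lo e ⊎ v ≡ Edge.hi e

data WalkIn {n : ℕ} (H : SimpleGraph n) (P : Fin n → Set) : Fin n → Fin n → Set where
  here : ∀ {u} → P u → WalkIn H P u u
  step : ∀ {u w x} → P u → Adj H u w → WalkIn H P w x → WalkIn H P u x

-- The grid A: k rows indexed by Fin k, columns indexed by 2-element
-- subsets {j,l} of Fin k (represented as j < l), columns ordered
-- lexicographically.

record Col (k : ℕ) : Set where
  constructor col
  field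
    j l  : Fin k
    .j<l : j <ᶠ l

SameCol : ∀ {k} → Col k → Col k → Set
SameCol c c' = Col.j c ≡ Col.j c' × Col.l c ≡ Col.l c'

InCol : ∀ {k} → Fin k → Col k → Set
InCol i c = i ≡ Col.j c ⊎ i ≡ Col.l c

_<lex_ : ∀ {k} → Col k → Col k → Set
c <lex c' = Col.j c <ᶠ Col.j c' ⊎ (Col.j c ≡ Col.j c' × Col.l c <ᶠ Col.l c')

ColSucc : ∀ {k} → Col k → Col k → Set
ColSucc {k} c c' = c <lex c' × (∀ (d : Col k) → ¬ (c <lex d × d <lex c'))

GridV : ℕ → Set
GridV k = Fin k × Col k

GridAdj : ∀ {k} → GridV k → GridV k → Set
GridAdj (i , c) (i' , c') =
    (SameCol c c' × (toℕ i' ≡ suc (toℕ i) ⊎ toℕ i ≡ suc (toℕ i')))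
  ⊎ (i ≡ i' × (ColSucc c c' ⊎ ColSucc c' c))

-- Minor maps m : V(A) → P(V(H)), subsets given by indicator functions.

record IsMinorMap (k : ℕ) {nH : ℕ} (H : SimpleGraph nH)
                  (m : GridV k → Fin nH → Bool) : Set where
  field
    nonempty  : ∀ a → ∃ λ u → T (m a u)
    connected : ∀ a u w → T (m a u) → T (m a w) → WalkIn H (λ x → T (m a x)) u w
    disjoint  : ∀ a a' u → T (m a u) → T (m a' u) → a ≡ a'
    edges     : ∀ a a' → GridAdj a a' →
                ∃ λ u → ∃ λ w → T (m a u) × T (m a' w) × Adj H u w

record Graph : Set₁ where
  field
    V : Set
    E : V → V → Set

IsoToSubgraphOf : Graph → ∀ {n} → SimpleGraph n → Set
IsoToSubgraphOf Γ {n} H =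
  Σ (Graph.V Γ → Fin n) λ φ →
    Injective _≡_ _≡_ φ × (∀ x y → Graph.E Γ x y → Adj H (φ x) (φ y))

IsoTo : Graph → ∀ {n} → SimpleGraph n → Set
IsoTo Γ {n} H =
  Σ (Graph.V Γ ↔ Fin n) λ φ →
    ∀ x y → (Graph.E Γ x y → Adj H (Inverse.to φ x) (Inverse.to φ y))
          × (Adj H (Inverse.to φ x) (Inverse.to φ y) → Graph.E Γ x y)

module Construction {nG : ℕ} (G : SimpleGraph nG) (k : ℕ)
                    {nH : ℕ} (H : SimpleGraph nH)
                    (m : GridV k → Fin nH → Bool)
                    (_≺_ : Rel (Fin nG) 0ℓ)
                    (ω : Fin nH ↔ Fin nH) where

  ω⁻¹ : Fin nH → Fin nH
  ω⁻¹ = Inverse.from ω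

  -- vertices of G_H: vertices of V_H' and copies u^{(v,e)} in
  -- H^{(v,e)}_{(i,{j,l})}
  data VGH : Set where
    orig : (u : Fin nH) → .(∀ a → ¬ T (m a u)) → VGH
    copy : (i : Fin k) (c : Col k) (v : Fin nG) (e : Edge G) →
           .(InCol i c → Incident v e) →
           (u : Fin nH) → .(T (m (i , c) u)) → VGH

  -- colouring f (colours 1..|V(H)| represented by Fin nH)
  f : VGH → Fin nH
  f (orig u _)           = Inverse.to ω u
  f (copy _ _ _ _ _ u _) = Inverse.to ω u

  -- Condition 2 (and conditions (1),(2) of the lemma)
  Cond2 : VGH → VGH → Set
  Cond2 (copy i c v e _ _ _) (copy i' c' v' e' _ _ _) =
    (i ≡ i' → v ≡ v') × (i <ᶠ i' → v ≺ v') × (SameCol c c' → e ≡ e')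
  Cond2 _ _ = ⊤

  AdjGH : VGH → VGH → Set
  AdjGH x y = Adj H (ω⁻¹ (f x)) (ω⁻¹ (f y)) × Cond2 x y

  Colourful : (VGH → Bool) → Set
  Colourful Y = (∀ c → ∃ λ x → T (Y x) × f x ≡ c)
              × (∀ x y → T (Y x) → T (Y y) → f x ≡ f y → x ≡ y)

  Induced : (VGH → Bool) → Graph
  Induced Y = record { V = Σ VGH (λ x → T (Y x))
                     ; E = λ x y → AdjGH (proj₁ x) (proj₁ y) }

module Submission where

-- Write colour x = ω⁻¹ (f x).  Since Y is colourful, colour
-- restricts to a bijection Y ↔ V(H), and by Condition 1 every edge of
-- G_H[Y] is mapped to an edge of H; this gives the first claim.  The
-- bijection is an isomorphism exactly when it also reflects edges, i.e.
-- when every pair of vertices of Y with H-adjacent colours satisfies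
-- Condition 2, which is the stated criterion.  The only non-trivial
-- point is the forward implication: if G_H[Y] is isomorphic to H by some
-- other bijection ψ, why must colour itself reflect edges?  Because
-- colour ∘ ψ⁻¹ is then a permutation of V(H) mapping edges to edges, and a
-- permutation of a finite set that preserves a relation also reflects it
-- (it cannot increase the finite number of related pairs).

open import Defs
open import Level using (0ℓ)
open import Data.Nat using (ℕ; zero; suc; _≤_; _<_; z≤n; s≤s)
open import Data.Nat.Properties
  using (+-mono-≤; +-mono-<-≤; +-mono-≤-<; +-0-commutativeMonoid; <-irrefl)
open import Data.Fin using (Fin; zero; suc)
open import Data.Bool using (Bool; T; true; false)
open import Data.Bool.Properties using (T-irrelevant)
open import Data.Unit using (tt)
open import Data.Product using (_×_; _,_; proj₁; proj₂; Σ; ∃)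
open import Data.Empty using (⊥-elim)
open import Data.Vec.Functional using (Vector)
open import Relation.Binary.Core using (Rel)
open import Relation.Binary.Structures using (IsStrictTotalOrder)
open import Relation.Binary.PropositionalEquality
  using (_≡_; refl; sym; trans; cong; subst; subst₂)
open import Function.Bundles using (_↔_; _⇔_; Inverse; Injection; mk↔ₛ′; mk⇔)
open import Function.Properties.Inverse using (↔⇒↣)
open import Function.Construct.Composition using (_↔-∘_)
open import Function.Construct.Symmetry using (↔-sym)
open import Algebra.Properties.CommutativeMonoid.Sum +-0-commutativeMonoid
  using (sum; sum-permute; sum-cong-≗)

-- The number of related pairs is counted by summing the indicator of a
-- Boolean relation; sums of natural numbers are monotone, and strictly so
-- when one summand grows strictly.

indicator : Bool → ℕ
indicator true  = 1
indicator false = 0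

indicator-T : ∀ b → T b → indicator b ≡ 1
indicator-T true _ = refl

sum-mono-≤ : ∀ {n} (g h : Vector ℕ n) → (∀ i → g i ≤ h i) → sum g ≤ sum h
sum-mono-≤ {zero}  g h g≤h = z≤n
sum-mono-≤ {suc n} g h g≤h =
  +-mono-≤ (g≤h zero) (sum-mono-≤ (λ i → g (suc i)) (λ i → h (suc i)) (λ i → g≤h (suc i)))

sum-mono-< : ∀ {n} (g h : Vector ℕ n) → (∀ i → g i ≤ h i) →
             ∀ i → g i < h i → sum g < sum h
sum-mono-< {suc n} g h g≤h zero    g<h =
  +-mono-<-≤ g<h (sum-mono-≤ (λ i → g (suc i)) (λ i → h (suc i)) (λ i → g≤h (suc i)))
sum-mono-< {suc n} g h g≤h (suc i) g<h =
  +-mono-≤-< (g≤h zero) (sum-mono-< (λ i → g (suc i)) (λ i → h (suc i)) (λ i → g≤h (suc i)) i g<h)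

-- A permutation σ of a finite set that maps R-related pairs to R-related
-- pairs also reflects R: otherwise the pair count of R ∘ (σ × σ) would
-- exceed that of R, although both are sums over the same index set.
permutation-reflects : ∀ {n} (R : Fin n → Fin n → Bool) (σ : Fin n ↔ Fin n) →
  let s = Inverse.to σ in
  (∀ a b → T (R a b) → T (R (s a) (s b))) →
  ∀ a b → T (R (s a) (s b)) → T (R a b)
permutation-reflects {n} R σ preserves a b related with R a b in eq
... | true  = tt
... | false = ⊥-elim (<-irrefl (sym count-invariant) count-grows)
  where
  s = Inverse.to σ

  count : (Fin n → Fin n → Bool) → ℕ
  count S = sum (λ x → sum (λ y → indicator (S x y)))

  count-invariant : count (λ x y → R (s x) (s y)) ≡ count R
  count-invariant =
    trans (sum-cong-≗ (λ x → sym (sum-permute (λ y → indicator (R (s x) y)) σ)))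
          (sym (sum-permute (λ x → sum (λ y → indicator (R x y))) σ))

  pointwise : ∀ x y → indicator (R x y) ≤ indicator (R (s x) (s y))
  pointwise x y with R x y in exy
  ... | false = z≤n
  ... | true  = subst (1 ≤_) (sym (indicator-T _ (preserves x y (subst T (sym exy) tt))))
                      (s≤s z≤n)

  strictly-at-ab : indicator (R a b) < indicator (R (s a) (s b))
  strictly-at-ab = subst₂ _<_ (cong indicator (sym eq)) (sym (indicator-T _ related)) (s≤s z≤n)

  count-grows : count R < count (λ x y → R (s x) (s y))
  count-grows = sum-mono-< _ _ (λ x → sum-mono-≤ _ _ (pointwise x)) a
                  (sum-mono-< _ _ (pointwise a) b strictly-at-ab)

-- Indeed,
-- for an isomorphism ψ, the permutation φ ∘ ψ⁻¹ of V(H) preserves edges,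
-- hence reflects them.
bijective-hom-reflects : (Γ : Graph) {n : ℕ} (H : SimpleGraph n) →
  IsoTo Γ H → (φ : Graph.V Γ ↔ Fin n) →
  (∀ x y → Graph.E Γ x y → Adj H (Inverse.to φ x) (Inverse.to φ y)) →
  ∀ x y → Adj H (Inverse.to φ x) (Inverse.to φ y) → Graph.E Γ x y
bijective-hom-reflects Γ H (ψ , ψ-iso) φ φ-hom x y φx~φy =
  proj₂ (ψ-iso x y) (permutation-reflects (SimpleGraph.adj H) σ σ-preserves
                       (ψ.to x) (ψ.to y) σψx~σψy)
  where
  module ψ = Inverse ψ

  σ : Fin _ ↔ Fin _
  σ = φ ↔-∘ ↔-sym ψ

  σ-preserves : ∀ a b → Adj H a b → Adj H (Inverse.to σ a) (Inverse.to σ b)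
  σ-preserves a b a~b =
    φ-hom (ψ.from a) (ψ.from b)
      (proj₂ (ψ-iso (ψ.from a) (ψ.from b))
        (subst₂ (Adj H) (sym (ψ.strictlyInverseˡ a)) (sym (ψ.strictlyInverseˡ b)) a~b))

  σψx~σψy : Adj H (Inverse.to σ (ψ.to x)) (Inverse.to σ (ψ.to y))
  σψx~σψy = subst₂ (λ x' y' → Adj H (Inverse.to φ x') (Inverse.to φ y'))
              (sym (ψ.strictlyInverseʳ x)) (sym (ψ.strictlyInverseʳ y)) φx~φy

colourful↔ : {X C : Set} (f : X → C) (Y : X → Bool) →
  (∀ c → ∃ λ x → T (Y x) × f x ≡ c) →
  (∀ x y → T (Y x) → T (Y y) → f x ≡ f y → x ≡ y) →
  Σ X (λ x → T (Y x)) ↔ C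
colourful↔ {X} f Y hits once = mk↔ₛ′ (λ x → f (proj₁ x)) pick f∘pick pick∘f
  where
  pick : _ → Σ X (λ x → T (Y x))
  pick c = proj₁ (hits c) , proj₁ (proj₂ (hits c))

  f∘pick : ∀ c → f (proj₁ (pick c)) ≡ c
  f∘pick c = proj₂ (proj₂ (hits c))

  pick∘f : ∀ x → pick (f (proj₁ x)) ≡ x
  pick∘f (x , x∈Y) with hits (f x)
  ... | x' , x'∈Y , fx'≡fx with once x' x x'∈Y x∈Y fx'≡fx
  ... | refl = cong (x ,_) (T-irrelevant x'∈Y x∈Y)

lemma4p2 : {nG : ℕ} (G : SimpleGraph nG) (k : ℕ) {nH : ℕ} (H : SimpleGraph nH)
    (m : GridV k → Fin nH → Bool) → IsMinorMap k H m →
    (_≺_ : Rel (Fin nG) 0ℓ) → IsStrictTotalOrder _≡_ _≺_ →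
    (ω : Fin nH ↔ Fin nH) →
    (Y : Construction.VGH G k H m _≺_ ω → Bool) →
    Construction.Colourful G k H m _≺_ ω Y →
    IsoToSubgraphOf (Construction.Induced G k H m _≺_ ω Y) H
    × (IsoTo (Construction.Induced G k H m _≺_ ω Y) H
       ⇔ (∀ x y → T (Y x) → T (Y y) →
            Adj H (Construction.ω⁻¹ G k H m _≺_ ω (Construction.f G k H m _≺_ ω x))
                  (Construction.ω⁻¹ G k H m _≺_ ω (Construction.f G k H m _≺_ ω y)) →
            Construction.Cond2 G k H m _≺_ ω x y))
lemma4p2 G k {nH} H m _ _≺_ _ ω Y (hits , once) =
  (Inverse.to colour , Injection.injective (↔⇒↣ colour) , colour-hom) ,
  mk⇔ only-if if
  where
  open Construction G k H m _≺_ ω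

  colour : Graph.V (Induced Y) ↔ Fin nH
  colour = ↔-sym ω ↔-∘ colourful↔ f Y hits once

  colour-hom : ∀ x y → Graph.E (Induced Y) x y →
               Adj H (Inverse.to colour x) (Inverse.to colour y)
  colour-hom x y = proj₁

  only-if : IsoTo (Induced Y) H →
            ∀ x y → T (Y x) → T (Y y) → Adj H (ω⁻¹ (f x)) (ω⁻¹ (f y)) → Cond2 x y
  only-if iso x y x∈Y y∈Y x~y =
    proj₂ (bijective-hom-reflects (Induced Y) H iso colour colour-hom (x , x∈Y) (y , y∈Y) x~y)

  if : (∀ x y → T (Y x) → T (Y y) → Adj H (ω⁻¹ (f x)) (ω⁻¹ (f y)) → Cond2 x y) →
       IsoTo (Induced Y) H
  if cond2 = colour , λ (x , x∈Y) (y , y∈Y) → proj₁ , λ x~y → x~y , cond2 x y x∈Y y∈Y x~y
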